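{- Let $G$ be an $n$-vertex graph and $\mu_1,\dots,\mu_n$ be the zeros of the matching polynomial of $G$. Then \[\operatorname{av}(G)=\frac12\sum_{j=1}^n\frac{\mu_j^2}{\mu_j^2+1}.\]
   Context: A matching of a graph is a set of pairwise vertex-disjoint edges; $m(G,k)$ denotes the number of matchings of cardinality $k$ in $G$, and $\operatorname{av}(G)=\frac{\sum_{k\ge0}k\,m(G,k)}{\sum_{k\ge0}m(G,k)}$ is the average size of a matching of $G$. The matching polynomial of an $n$-vertex graph $G$ is $\Phi(G,x)=\sum_{k\geq 0}m(G,k)(-1)^k x^{n-2k}$; its zeros are all real. -}

module Defs where

open import Level using (0ℓ)
open import Data.Bool using (Bool; true; false; T; _∧_; not)
open import Data.Nat as ℕ using (ℕ; zero; suc)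
open import Data.Fin as Fin using (Fin)
open import Data.Fin.Properties using () renaming (_≟_ to _≟ᶠ_)
open import Data.List as List using (List; []; _∷_; length; filterᵇ; concatMap; allFin; upTo)
open import Data.Product using (Σ; ∃; _×_; _,_)
open import Relation.Nullary using (¬_; does)
open import Relation.Binary.PropositionalEquality using (_≡_)
open import Data.Sum using (_⊎_)
import Algebra.Structures as AS

-- The real numbers, axiomatised as a (Dedekind-)complete ordered field.
-- Any two models are isomorphic to ℝ, so quantifying over all models
-- is the same as speaking about ℝ.  Inverse is made total with
-- inv 0 = 0 (only used at nonzero arguments in the statement).

record RealField : Set₁ where
  infixl 6 _+_ _-_
  infixl 7 _*_ _/_
  infix 4 _≤_
  field
    R    : Set
    _+_  : R → R → R
    _*_  : R → R → R
    -_   : R → R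
    0r   : R
    1r   : R
    inv  : R → R
    _≤_  : R → R → Set
    isCommutativeRing : AS.IsCommutativeRing {A = R} _≡_ _+_ _*_ -_ 0r 1r
    0≢1      : ¬ (0r ≡ 1r)
    inv-r    : ∀ x → ¬ (x ≡ 0r) → x * inv x ≡ 1r
    inv-0    : inv 0r ≡ 0r
    ≤-refl   : ∀ x → x ≤ x
    ≤-trans  : ∀ {x y z} → x ≤ y → y ≤ z → x ≤ z
    ≤-antisym : ∀ {x y} → x ≤ y → y ≤ x → x ≡ y
    ≤-total  : ∀ x y → (x ≤ y) ⊎ (y ≤ x)
    +-mono-≤ : ∀ {x y} z → x ≤ y → x + z ≤ y + z
    *-nonneg : ∀ {x y} → 0r ≤ x → 0r ≤ y → 0r ≤ x * y
    complete : (P : R → Set) → Σ R P →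
               Σ R (λ b → ∀ x → P x → x ≤ b) →
               Σ R (λ s → (∀ x → P x → x ≤ s) ×
                          (∀ b → (∀ x → P x → x ≤ b) → s ≤ b))

  _-_ : R → R → R
  x - y = x + (- y)

  _/_ : R → R → R
  x / y = x * inv y

  fromℕ : ℕ → R
  fromℕ zero    = 0r
  fromℕ (suc k) = 1r + fromℕ k

  _^_ : R → ℕ → R
  x ^ zero  = 1r
  x ^ suc k = x * (x ^ k)

  sgn : ℕ → R
  sgn zero    = 1r
  sgn (suc k) = - sgn k

  ∑ : ∀ {n} → (Fin n → R) → R
  ∑ {zero}  f = 0r
  ∑ {suc n} f = f Fin.zero + ∑ (λ i → f (Fin.suc i))

  ∏ : ∀ {n} → (Fin n → R) → R
  ∏ {zero}  f = 1r
  ∏ {suc n} f = f Fin.zero * ∏ (λ i → f (Fin.suc i))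

  ∑≤ : ℕ → (ℕ → R) → R
  ∑≤ n f = List.foldr (λ k acc → f k + acc) 0r (upTo (suc n))


record Graph (n : ℕ) : Set where
  field
    adj       : Fin n → Fin n → Bool
    symmetric : ∀ i j → adj i j ≡ adj j i
    irreflex  : ∀ i → adj i i ≡ false

Edge : ℕ → Set
Edge n = Fin n × Fin n

edges : ∀ {n} → Graph n → List (Edge n)
edges {n} G = filterᵇ (λ e → ltᶠ (fst e) (snd e) ∧ Graph.adj G (fst e) (snd e))
                      (concatMap (λ i → List.map (λ j → i , j) (allFin n)) (allFin n))
  where
    fst : Edge n → Fin n
    fst (i , _) = i
    snd : Edge n → Fin n
    snd (_ , j) = j
    ltᶠ : Fin n → Fin n → Bool
    ltᶠ i j = Fin.toℕ i ℕ.<ᵇ Fin.toℕ j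

subsets : ∀ {A : Set} → List A → List (List A)
subsets []       = [] ∷ []
subsets (x ∷ xs) = subsets xs List.++ List.map (x ∷_) (subsets xs)

eqᶠ : ∀ {n} → Fin n → Fin n → Bool
eqᶠ i j = does (i ≟ᶠ j)

disjointᵇ : ∀ {n} → Edge n → Edge n → Bool
disjointᵇ (a , b) (c , d) = not (eqᶠ a c) ∧ not (eqᶠ a d) ∧ not (eqᶠ b c) ∧ not (eqᶠ b d)

allᵇ : ∀ {A : Set} → (A → Bool) → List A → Bool
allᵇ p []       = true
allᵇ p (x ∷ xs) = p x ∧ allᵇ p xs

isMatchingᵇ : ∀ {n} → List (Edge n) → Bool
isMatchingᵇ []       = true
isMatchingᵇ (e ∷ es) = allᵇ (disjointᵇ e) es ∧ isMatchingᵇ es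

m : ∀ {n} → Graph n → ℕ → ℕ
m G k = length (filterᵇ (λ M → isMatchingᵇ M ∧ (length M ℕ.≡ᵇ k)) (subsets (edges G)))

module _ (ℝ : RealField) where
  open RealField ℝ

  -- matching polynomial Φ(G,x) = Σ_k m(G,k) (-1)^k x^(n-2k)
  -- (terms with 2k > n vanish since then m(G,k) = 0)
  Φ : ∀ {n} → Graph n → R → R
  Φ {n} G x = ∑≤ n (λ k → fromℕ (m G k) * sgn k * (x ^ (n ℕ.∸ (2 ℕ.* k))))

  -- average size of a matching (k ranges over 0..n, beyond which m(G,k) = 0)
  av : ∀ {n} → Graph n → R
  av {n} G = ∑≤ n (λ k → fromℕ k * fromℕ (m G k)) / ∑≤ n (λ k → fromℕ (m G k))

{-# OPTIONS --safe #-}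
-- Evaluate Φ(x) = ∏ⱼ (x − μⱼ) at x = i + ε, where i² = −1 and ε² = 0 (dual numbers over the
-- Gaussian extension of ℝ); this is legitimate because both sides are polynomials that agree at
-- every natural number. As (i + ε)ᵉ = iᵉ (1 − e i ε), the left side is iⁿ (S₀ + (2S₁ − n S₀) i ε)
-- with S₀ = Σₖ m(G,k) and S₁ = Σₖ k m(G,k), while the right side is P (1 + Σⱼ ε / (i − μⱼ)) with
-- P = ∏ⱼ (i − μⱼ) = iⁿ S₀. Comparing ε-parts and taking imaginary parts gives
-- 2S₁ − n S₀ = −S₀ Σⱼ 1 / (μⱼ² + 1), that is 2 av(G) = 2S₁ / S₀ = Σⱼ μⱼ² / (μⱼ² + 1).

module Submission where

open import Defs
open import Level using (0ℓ)
open import Algebra.Bundles using (CommutativeRing; RawRing; Semiring)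
open import Algebra.Structures using (IsCommutativeRing)
open import Algebra.Morphism.Structures using (module RingMorphisms)
open RingMorphisms using (IsRingHomomorphism)
import Algebra.Morphism.Construct.Identity as Identity
import Algebra.Morphism.Construct.Composition as Composition
open import Algebra.Solver.Ring.AlmostCommutativeRing using (_-Raw-AlmostCommutative⟶_; fromCommutativeRing)
open import Data.Bool using (Bool; T; _∧_; not)
open import Data.Bool.Properties using (T?; T-∧)
open import Data.Nat as ℕ using (ℕ; zero; suc)
import Data.Nat.Properties as ℕ
open import Data.Fin as Fin using (Fin)
import Data.Fin.Properties as Fin
open import Data.List as List using (List; []; _∷_; length; filterᵇ; upTo)
open import Data.List.Properties using (filter-none; filter-some)
open import Data.List.Relation.Unary.All as All using (All; []; _∷_)
open import Data.List.Relation.Unary.All.Properties using (++⁺; map⁺; all-filter)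
open import Data.List.Relation.Unary.Any as Any using (Any; here)
open import Data.List.Relation.Unary.Any.Properties using (++⁺ˡ)
open import Data.List.Relation.Unary.AllPairs using ([]; _∷_)
open import Data.List.Relation.Unary.Unique.Propositional using (Unique)
open import Data.List.Membership.Propositional.Properties using (∈-lookup)
open import Data.Maybe using (Maybe; just; nothing)
open import Data.Product using (_×_; _,_; proj₁; proj₂)
open import Data.Product.Properties using (≡-dec)
open import Data.Sum using (_⊎_; inj₁; inj₂)
open import Data.Empty using (⊥-elim)
open import Function using (_∘_; Equivalence)
open import Relation.Nullary using (¬_; yes; no; contradiction)
open import Relation.Binary.PropositionalEquality

module CommutativeRingTheory {A : Set} {add mul : A → A → A} {neg : A → A} {zero# one# : A}
  (isCR : IsCommutativeRing _≡_ add mul neg zero# one#) where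

  commutativeRing : CommutativeRing 0ℓ 0ℓ
  commutativeRing = record { isCommutativeRing = isCR }

  open CommutativeRing commutativeRing public hiding (refl; sym; trans; reflexive; setoid; isEquivalence)
  open import Algebra.Properties.Ring ring public using (-‿distribˡ-*; -‿distribʳ-*; -‿involutive; -0#≈0#; -1*x≈-x)
  open import Algebra.Properties.AbelianGroup +-abelianGroup public using (⁻¹-∙-comm; ⁻¹-anti-homo‿-)
  open import Algebra.Properties.CommutativeSemigroup +-commutativeSemigroup public using (interchange)
  open import Algebra.Definitions.RawSemiring (Semiring.rawSemiring semiring) public using (_^_; sum; product)
    renaming (_×_ to _·_)
  open import Algebra.Properties.Semiring.Mult semiring public using ()
    renaming (×-homo-+ to ·-homo-+; ×1-homo-* to ·1-homo-*)
  open import Algebra.Properties.Semiring.Exp semiring public using (^-homo-*)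
  open import Algebra.Properties.Monoid.Sum +-monoid public using (sum-cong-≗)
  open import Algebra.Properties.Monoid.Sum *-monoid public using () renaming (sum-cong-≗ to product-cong-≗)
  open ≡-Reasoning

  sumOver : {I : Set} → List I → (I → A) → A
  sumOver L f = List.foldr (λ k acc → f k + acc) 0# L

  sumOver-cong : ∀ {I : Set} (L : List I) {f g : I → A} → (∀ k → f k ≡ g k) → sumOver L f ≡ sumOver L g
  sumOver-cong []      f≗g = refl
  sumOver-cong (k ∷ L) f≗g = cong₂ _+_ (f≗g k) (sumOver-cong L f≗g)

  *-distribˡ-sumOver : ∀ {I : Set} x (L : List I) (f : I → A) → sumOver L (λ k → x * f k) ≡ x * sumOver L f
  *-distribˡ-sumOver x []      f = sym (zeroʳ x)
  *-distribˡ-sumOver x (k ∷ L) f = trans (cong (x * f k +_) (*-distribˡ-sumOver x L f)) (sym (distribˡ x _ _))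

  invertible⇒*-cancelˡ : ∀ {x y a b} → y * x ≡ 1# → x * a ≡ x * b → a ≡ b
  invertible⇒*-cancelˡ {x} {y} {a} {b} yx≡1 xa≡xb = begin
    a             ≡⟨ sym (*-identityˡ a) ⟩
    1# * a        ≡⟨ cong (_* a) (sym yx≡1) ⟩
    (y * x) * a   ≡⟨ *-assoc y x a ⟩
    y * (x * a)   ≡⟨ cong (y *_) xa≡xb ⟩
    y * (x * b)   ≡⟨ sym (*-assoc y x b) ⟩
    (y * x) * b   ≡⟨ cong (_* b) yx≡1 ⟩
    1# * b        ≡⟨ *-identityˡ b ⟩
    b             ∎

  -‿+-distrib : ∀ x y → - (x + y) ≡ - x - y
  -‿+-distrib x y = sym (⁻¹-∙-comm x y)

  -‿cross : ∀ {x y u v} → x + v ≡ u + y → x - y ≡ u - v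
  -‿cross {x} {y} {u} {v} eq = begin
    x - y               ≡⟨ sym (+-identityʳ _) ⟩
    (x - y) + 0#        ≡⟨ cong ((x - y) +_) (sym (-‿inverseʳ v)) ⟩
    (x - y) + (v - v)   ≡⟨ interchange x (- y) v (- v) ⟩
    (x + v) + (- y - v) ≡⟨ cong₂ _+_ eq (+-comm (- y) (- v)) ⟩
    (u + y) + (- v - y) ≡⟨ interchange u y (- v) (- y) ⟩
    (u - v) + (y - y)   ≡⟨ cong ((u - v) +_) (-‿inverseʳ y) ⟩
    (u - v) + 0#        ≡⟨ +-identityʳ _ ⟩
    u - v               ∎

  -‿*-expand : ∀ a b c d → (a - b) * (c - d) ≡ (a * c + b * d) - (a * d + b * c)
  -‿*-expand a b c d = begin
    (a - b) * (c - d)                       ≡⟨ distribˡ _ _ _ ⟩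
    (a - b) * c + (a - b) * - d             ≡⟨ cong₂ _+_ (distribʳ _ _ _) (distribʳ _ _ _) ⟩
    (a * c + - b * c) + (a * - d + - b * - d)
      ≡⟨ cong₂ (λ s t → (a * c + s) + (t + - b * - d)) (sym (-‿distribˡ-* b c)) (sym (-‿distribʳ-* a d)) ⟩
    (a * c - b * c) + (- (a * d) + - b * - d)
      ≡⟨ cong (λ t → (a * c - b * c) + (- (a * d) + t))
              (trans (sym (-‿distribˡ-* b (- d))) (trans (cong -_ (sym (-‿distribʳ-* b d))) (-‿involutive _))) ⟩
    (a * c - b * c) + (- (a * d) + b * d)   ≡⟨ cong ((a * c - b * c) +_) (+-comm _ _) ⟩
    (a * c - b * c) + (b * d - a * d)       ≡⟨ interchange _ _ _ _ ⟩
    (a * c + b * d) + (- (b * c) - a * d)   ≡⟨ cong ((a * c + b * d) +_) (trans (+-comm _ _) (sym (-‿+-distrib _ _))) ⟩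
    (a * c + b * d) - (a * d + b * c)       ∎

  private
    -- Solver coefficients: a pair (a , b) of naturals stands for the integer a − b.
    -- Pairs are normalised to (a ∸ b , b ∸ a), so that _≡_ decides equality of coefficients.
    ℤ′ : Set
    ℤ′ = ℕ × ℕ

    normalise : ℕ → ℕ → ℤ′
    normalise a b = (a ℕ.∸ b , b ℕ.∸ a)

    ⟦_⟧ℤ′ : ℤ′ → A
    ⟦ a , b ⟧ℤ′ = a · 1# - b · 1#

    ⟦normalise⟧ : ∀ a b → ⟦ normalise a b ⟧ℤ′ ≡ ⟦ a , b ⟧ℤ′
    ⟦normalise⟧ a b = -‿cross (begin
      (a ℕ.∸ b) · 1# + b · 1#    ≡⟨ sym (·-homo-+ 1# (a ℕ.∸ b) b) ⟩
      (a ℕ.∸ b ℕ.+ b) · 1#        ≡⟨ cong (_· 1#) (∸-+-swap a b) ⟩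
      (a ℕ.+ (b ℕ.∸ a)) · 1#      ≡⟨ ·-homo-+ 1# a (b ℕ.∸ a) ⟩
      a · 1# + (b ℕ.∸ a) · 1#    ∎)
      where
      ∸-+-swap : ∀ a b → a ℕ.∸ b ℕ.+ b ≡ a ℕ.+ (b ℕ.∸ a)
      ∸-+-swap zero    zero    = refl
      ∸-+-swap (suc a) zero    = refl
      ∸-+-swap zero    (suc b) = refl
      ∸-+-swap (suc a) (suc b) = trans (ℕ.+-suc (a ℕ.∸ b) b) (cong suc (∸-+-swap a b))

    coefficients : RawRing 0ℓ 0ℓ
    coefficients = record
      { Carrier = ℤ′ ; _≈_ = _≡_ ; 0# = (0 , 0) ; 1# = (1 , 0) ; -_ = λ { (a , b) → (b , a) }
      ; _+_ = λ { (a , b) (c , d) → normalise (a ℕ.+ c) (b ℕ.+ d) }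
      ; _*_ = λ { (a , b) (c , d) → normalise (a ℕ.* c ℕ.+ b ℕ.* d) (a ℕ.* d ℕ.+ b ℕ.* c) } }

    -- The interpretation given to the solver: it computes to 0# and 1# on the
    -- coefficients 0 and 1, so that solved equations match goals literally.
    fromℕ′ : ℕ → A
    fromℕ′ zero          = 0#
    fromℕ′ (suc zero)    = 1#
    fromℕ′ (suc (suc k)) = 1# + fromℕ′ (suc k)

    ⟦_⟧ᶜ : ℤ′ → A
    ⟦ a     , zero  ⟧ᶜ = fromℕ′ a
    ⟦ zero  , suc b ⟧ᶜ = - fromℕ′ (suc b)
    ⟦ suc a , suc b ⟧ᶜ = ⟦ a , b ⟧ᶜ

    fromℕ′≗·1 : ∀ k → fromℕ′ k ≡ k · 1#
    fromℕ′≗·1 zero          = refl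
    fromℕ′≗·1 (suc zero)    = sym (+-identityʳ _)
    fromℕ′≗·1 (suc (suc k)) = cong (1# +_) (fromℕ′≗·1 (suc k))

    ⟦⟧ᶜ≗⟦⟧ℤ′ : ∀ p → ⟦ p ⟧ᶜ ≡ ⟦ p ⟧ℤ′
    ⟦⟧ᶜ≗⟦⟧ℤ′ (a , zero) = begin
      fromℕ′ a      ≡⟨ fromℕ′≗·1 a ⟩
      a · 1#       ≡⟨ sym (+-identityʳ _) ⟩
      a · 1# + 0#  ≡⟨ cong (a · 1# +_) (sym -0#≈0#) ⟩
      a · 1# - 0#  ∎
    ⟦⟧ᶜ≗⟦⟧ℤ′ (zero , suc b) = trans (cong -_ (fromℕ′≗·1 (suc b))) (sym (+-identityˡ _))
    ⟦⟧ᶜ≗⟦⟧ℤ′ (suc a , suc b) =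
      trans (⟦⟧ᶜ≗⟦⟧ℤ′ (a , b)) (-‿cross (trans (sym (+-assoc _ _ _)) (cong (_+ b · 1#) (+-comm _ _))))

    module C = RawRing coefficients

    ⟦⟧ℤ′-homo-+ : ∀ p q → ⟦ p C.+ q ⟧ℤ′ ≡ ⟦ p ⟧ℤ′ + ⟦ q ⟧ℤ′
    ⟦⟧ℤ′-homo-+ (a , b) (c , d) = begin
      ⟦ normalise (a ℕ.+ c) (b ℕ.+ d) ⟧ℤ′       ≡⟨ ⟦normalise⟧ (a ℕ.+ c) (b ℕ.+ d) ⟩
      (a ℕ.+ c) · 1# - (b ℕ.+ d) · 1#         ≡⟨ cong₂ _-_ (·-homo-+ 1# a c) (·-homo-+ 1# b d) ⟩
      (a · 1# + c · 1#) - (b · 1# + d · 1#) ≡⟨ cong ((a · 1# + c · 1#) +_) (-‿+-distrib _ _) ⟩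
      (a · 1# + c · 1#) + (- (b · 1#) - d · 1#) ≡⟨ interchange _ _ _ _ ⟩
      (a · 1# - b · 1#) + (c · 1# - d · 1#) ∎

    ⟦⟧ℤ′-homo-* : ∀ p q → ⟦ p C.* q ⟧ℤ′ ≡ ⟦ p ⟧ℤ′ * ⟦ q ⟧ℤ′
    ⟦⟧ℤ′-homo-* (a , b) (c , d) = begin
      ⟦ normalise (a ℕ.* c ℕ.+ b ℕ.* d) (a ℕ.* d ℕ.+ b ℕ.* c) ⟧ℤ′
        ≡⟨ ⟦normalise⟧ (a ℕ.* c ℕ.+ b ℕ.* d) (a ℕ.* d ℕ.+ b ℕ.* c) ⟩
      (a ℕ.* c ℕ.+ b ℕ.* d) · 1# - (a ℕ.* d ℕ.+ b ℕ.* c) · 1#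
        ≡⟨ cong₂ _-_ (·1-+*+ a c b d) (·1-+*+ a d b c) ⟩
      (a · 1# * c · 1# + b · 1# * d · 1#) - (a · 1# * d · 1# + b · 1# * c · 1#)
        ≡⟨ sym (-‿*-expand _ _ _ _) ⟩
      (a · 1# - b · 1#) * (c · 1# - d · 1#) ∎
      where
      ·1-+*+ : ∀ w x y z → (w ℕ.* x ℕ.+ y ℕ.* z) · 1# ≡ w · 1# * x · 1# + y · 1# * z · 1#
      ·1-+*+ w x y z = trans (·-homo-+ 1# (w ℕ.* x) (y ℕ.* z)) (cong₂ _+_ (·1-homo-* w x) (·1-homo-* y z))

    ⟦⟧ℤ′-homo-- : ∀ p → ⟦ C.- p ⟧ℤ′ ≡ - ⟦ p ⟧ℤ′
    ⟦⟧ℤ′-homo-- (a , b) = sym (⁻¹-anti-homo‿- (a · 1#) (b · 1#))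

    lift : ∀ {f : ℤ′ → ℤ′ → ℤ′} {g : A → A → A} →
           (∀ p q → ⟦ f p q ⟧ℤ′ ≡ g ⟦ p ⟧ℤ′ ⟦ q ⟧ℤ′) → ∀ p q → ⟦ f p q ⟧ᶜ ≡ g ⟦ p ⟧ᶜ ⟦ q ⟧ᶜ
    lift {f} {g} homo p q = trans (⟦⟧ᶜ≗⟦⟧ℤ′ (f p q))
      (trans (homo p q) (sym (cong₂ g (⟦⟧ᶜ≗⟦⟧ℤ′ p) (⟦⟧ᶜ≗⟦⟧ℤ′ q))))

    morphism : coefficients -Raw-AlmostCommutative⟶ fromCommutativeRing commutativeRing
    morphism = record
      { ⟦_⟧    = ⟦_⟧ᶜ
      ; +-homo = lift {C._+_} {_+_} ⟦⟧ℤ′-homo-+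
      ; *-homo = lift {C._*_} {_*_} ⟦⟧ℤ′-homo-*
      ; -‿homo = λ p → trans (⟦⟧ᶜ≗⟦⟧ℤ′ (C.- p)) (trans (⟦⟧ℤ′-homo-- p) (sym (cong -_ (⟦⟧ᶜ≗⟦⟧ℤ′ p))))
      ; 0-homo = refl
      ; 1-homo = refl
      }

    coefficient? : ∀ p q → Maybe (⟦ p ⟧ᶜ ≡ ⟦ q ⟧ᶜ)
    coefficient? p q with ≡-dec ℕ._≟_ ℕ._≟_ p q
    ... | yes refl = just refl
    ... | no _     = nothing

  open import Algebra.Solver.Ring coefficients (fromCommutativeRing commutativeRing) morphism coefficient? public
    using (Polynomial; solve; _:=_; _:+_; _:*_; :-_; _:-_; con)

  :0 :1 : ∀ {n} → Polynomial n
  :0 = con (0 , 0)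
  :1 = con (1 , 0)

  sum-1#+ : ∀ {n} (f : Fin n → A) → sum (λ j → 1# + f j) ≡ n · 1# + sum f
  sum-1#+ {zero}  f = sym (+-identityˡ 0#)
  sum-1#+ {suc n} f = begin
    (1# + f Fin.zero) + sum (λ j → 1# + f (Fin.suc j))  ≡⟨ cong ((1# + f Fin.zero) +_) (sum-1#+ (λ j → f (Fin.suc j))) ⟩
    (1# + f Fin.zero) + (n · 1# + sum (λ j → f (Fin.suc j)))
      ≡⟨ solve 3 (λ a k s → (:1 :+ a) :+ (k :+ s) := (:1 :+ k) :+ (a :+ s)) refl (f Fin.zero) (n · 1#) (sum (λ j → f (Fin.suc j))) ⟩
    (1# + n · 1#) + (f Fin.zero + sum (λ j → f (Fin.suc j))) ∎

mkIsCommutativeRing : {A : Set} (_+_ _*_ : A → A → A) (-_ : A → A) (0# 1# : A) →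
  (∀ x y z → (x + y) + z ≡ x + (y + z)) →
  (∀ x y → x + y ≡ y + x) →
  (∀ x → 0# + x ≡ x) →
  (∀ x → (- x) + x ≡ 0#) →
  (∀ x y z → (x * y) * z ≡ x * (y * z)) →
  (∀ x y → x * y ≡ y * x) →
  (∀ x → 1# * x ≡ x) →
  (∀ x y z → (y + z) * x ≡ (y * x) + (z * x)) →
  IsCommutativeRing _≡_ _+_ _*_ -_ 0# 1#
mkIsCommutativeRing _+_ _*_ -_ 0# 1# +-assoc +-comm +-identityˡ -‿inverseˡ *-assoc *-comm *-identityˡ distribʳ = record
  { isRing = record
    { +-isAbelianGroup = record
      { isGroup = record
        { isMonoid = record
          { isSemigroup = record
            { isMagma = record { isEquivalence = isEquivalence ; ∙-cong = cong₂ _+_ }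
            ; assoc = +-assoc }
          ; identity = +-identityˡ , λ x → trans (+-comm x 0#) (+-identityˡ x) }
        ; inverse = -‿inverseˡ , λ x → trans (+-comm x (- x)) (-‿inverseˡ x)
        ; ⁻¹-cong = cong -_ }
      ; comm = +-comm }
    ; *-cong = cong₂ _*_
    ; *-assoc = *-assoc
    ; *-identity = *-identityˡ , λ x → trans (*-comm x 1#) (*-identityˡ x)
    ; distrib = (λ x y z → trans (*-comm x (y + z)) (trans (distribʳ x y z) (cong₂ _+_ (*-comm y x) (*-comm z x))))
              , distribʳ }
  ; *-comm = *-comm }

mkIsRingHomomorphism : {A B : Set}
  {_+₁_ _*₁_ : A → A → A} { -₁_ : A → A} {0#₁ 1#₁ : A}
  {_+₂_ _*₂_ : B → B → B} { -₂_ : B → B} {0#₂ 1#₂ : B}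
  (f : A → B) →
  (∀ x y → f (x +₁ y) ≡ f x +₂ f y) → (∀ x y → f (x *₁ y) ≡ f x *₂ f y) → (∀ x → f (-₁ x) ≡ -₂ f x) →
  f 0#₁ ≡ 0#₂ → f 1#₁ ≡ 1#₂ →
  IsRingHomomorphism (record { _≈_ = _≡_ ; _+_ = _+₁_ ; _*_ = _*₁_ ; -_ = -₁_ ; 0# = 0#₁ ; 1# = 1#₁ })
                     (record { _≈_ = _≡_ ; _+_ = _+₂_ ; _*_ = _*₂_ ; -_ = -₂_ ; 0# = 0#₂ ; 1# = 1#₂ }) f
mkIsRingHomomorphism f +-homo *-homo -‿homo 0#-homo 1#-homo = record
  { isSemiringHomomorphism = record
    { isNearSemiringHomomorphism = record
      { +-isMonoidHomomorphism = record
        { isMagmaHomomorphism = record { isRelHomomorphism = record { cong = cong f } ; homo = +-homo }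
        ; ε-homo = 0#-homo }
      ; *-homo = *-homo }
    ; 1#-homo = 1#-homo }
  ; -‿homo = -‿homo }

module GaussianExtension {A : Set} {add mul : A → A → A} {neg : A → A} {zero# one# : A}
  (isCR : IsCommutativeRing _≡_ add mul neg zero# one#) where

  private module R = CommutativeRingTheory isCR
  open R using (solve; _:=_; _:+_; _:*_; :-_; _:-_; :0; :1)

  infixl 6 _+_
  infixl 7 _*_
  infix  8 -_

  A[i] : Set
  A[i] = A × A

  _+_ _*_ : A[i] → A[i] → A[i]
  (a , b) + (c , d) = (a R.+ c , b R.+ d)
  (a , b) * (c , d) = (a R.* c R.- b R.* d , a R.* d R.+ b R.* c)

  -_ : A[i] → A[i]
  - (a , b) = (R.- a , R.- b)

  0# 1# i : A[i]
  0# = (R.0# , R.0#)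
  1# = (R.1# , R.0#)
  i  = (R.0# , R.1#)

  isCommutativeRing : IsCommutativeRing _≡_ _+_ _*_ -_ 0# 1#
  isCommutativeRing = mkIsCommutativeRing _+_ _*_ -_ 0# 1#
    (λ { (a , b) (c , d) (e , f) → cong₂ _,_ (R.+-assoc a c e) (R.+-assoc b d f) })
    (λ { (a , b) (c , d) → cong₂ _,_ (R.+-comm a c) (R.+-comm b d) })
    (λ { (a , b) → cong₂ _,_ (R.+-identityˡ a) (R.+-identityˡ b) })
    (λ { (a , b) → cong₂ _,_ (R.-‿inverseˡ a) (R.-‿inverseˡ b) })
    (λ { (a , b) (c , d) (e , f) → cong₂ _,_
        (solve 6 (λ a b c d e f → (a :* c :- b :* d) :* e :- (a :* d :+ b :* c) :* f := a :* (c :* e :- d :* f) :- b :* (c :* f :+ d :* e)) refl a b c d e f)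
        (solve 6 (λ a b c d e f → (a :* c :- b :* d) :* f :+ (a :* d :+ b :* c) :* e := a :* (c :* f :+ d :* e) :+ b :* (c :* e :- d :* f)) refl a b c d e f) })
    (λ { (a , b) (c , d) → cong₂ _,_
        (solve 4 (λ a b c d → a :* c :- b :* d := c :* a :- d :* b) refl a b c d)
        (solve 4 (λ a b c d → a :* d :+ b :* c := c :* b :+ d :* a) refl a b c d) })
    (λ { (a , b) → cong₂ _,_
        (solve 2 (λ a b → :1 :* a :- :0 :* b := a) refl a b)
        (solve 2 (λ a b → :1 :* b :+ :0 :* a := b) refl a b) })
    (λ { (a , b) (c , d) (e , f) → cong₂ _,_
        (solve 6 (λ a b c d e f → (c :+ e) :* a :- (d :+ f) :* b := (c :* a :- d :* b) :+ (e :* a :- f :* b)) refl a b c d e f)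
        (solve 6 (λ a b c d e f → (c :+ e) :* b :+ (d :+ f) :* a := (c :* b :+ d :* a) :+ (e :* b :+ f :* a)) refl a b c d e f) })

  private module C = CommutativeRingTheory isCommutativeRing

  embed : A → A[i]
  embed a = (a , R.0#)

  embed-isRingHomomorphism : IsRingHomomorphism R.rawRing C.rawRing embed
  embed-isRingHomomorphism = mkIsRingHomomorphism embed
    (λ a b → cong (a R.+ b ,_) (solve 0 (:0 := :0 :+ :0) refl))
    (λ a b → cong₂ _,_ (solve 2 (λ a b → a :* b := a :* b :- :0 :* :0) refl a b)
                       (solve 2 (λ a b → :0 := a :* :0 :+ :0 :* b) refl a b))
    (λ a → cong (R.- a ,_) (solve 0 (:0 := :- :0) refl))
    refl refl

  i*-i≡1 : i * - i ≡ 1#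
  i*-i≡1 = cong₂ _,_ (solve 0 (:0 :* (:- :0) :- :1 :* (:- :1) := :1) refl)
                     (solve 0 (:0 :* (:- :1) :+ :1 :* (:- :0) := :0) refl)

  i*i≡-1 : i * i ≡ - 1#
  i*i≡-1 = cong₂ _,_ (solve 0 (:0 :* :0 :- :1 :* :1 := :- :1) refl)
                     (solve 0 (:0 :* :1 :+ :1 :* :0 := :- :0) refl)

  ·1≡embed : ∀ m → m C.· 1# ≡ embed (m R.· R.1#)
  ·1≡embed zero    = refl
  ·1≡embed (suc m) = cong₂ _,_ (cong (R.1# R.+_) (cong proj₁ (·1≡embed m)))
                                 (trans (cong (R.0# R.+_) (cong proj₂ (·1≡embed m))) (R.+-identityˡ R.0#))

  embed-sumOver : ∀ {I : Set} (L : List I) (f : I → A) → C.sumOver L (λ k → embed (f k)) ≡ embed (R.sumOver L f)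
  embed-sumOver []      f = refl
  embed-sumOver (k ∷ L) f = cong₂ _,_ (cong (f k R.+_) (cong proj₁ (embed-sumOver L f)))
                                      (trans (cong (R.0# R.+_) (cong proj₂ (embed-sumOver L f))) (R.+-identityˡ R.0#))

  im-embed* : ∀ x w → proj₂ (embed x * w) ≡ x R.* proj₂ w
  im-embed* x (u , v) = solve 3 (λ x u v → x :* v :+ :0 :* u := x :* v) refl x u v

  im-sum : ∀ {n} (f : Fin n → A[i]) → proj₂ (C.sum f) ≡ R.sum (λ j → proj₂ (f j))
  im-sum {zero}  f = refl
  im-sum {suc n} f = cong (proj₂ (f Fin.zero) R.+_) (im-sum (λ j → f (Fin.suc j)))

module DualNumbers {A : Set} {add mul : A → A → A} {neg : A → A} {zero# one# : A}
  (isCR : IsCommutativeRing _≡_ add mul neg zero# one#) where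

  private module R = CommutativeRingTheory isCR
  open R using (solve; _:=_; _:+_; _:*_; :-_; _:-_; :0; :1)

  infixl 6 _+_
  infixl 7 _*_
  infix  8 -_

  A[ε] : Set
  A[ε] = A × A

  _+_ _*_ : A[ε] → A[ε] → A[ε]
  (a , b) + (c , d) = (a R.+ c , b R.+ d)
  (a , b) * (c , d) = (a R.* c , a R.* d R.+ b R.* c)

  -_ : A[ε] → A[ε]
  - (a , b) = (R.- a , R.- b)

  0# 1# : A[ε]
  0# = (R.0# , R.0#)
  1# = (R.1# , R.0#)

  isCommutativeRing : IsCommutativeRing _≡_ _+_ _*_ -_ 0# 1#
  isCommutativeRing = mkIsCommutativeRing _+_ _*_ -_ 0# 1#
    (λ { (a , b) (c , d) (e , f) → cong₂ _,_ (R.+-assoc a c e) (R.+-assoc b d f) })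
    (λ { (a , b) (c , d) → cong₂ _,_ (R.+-comm a c) (R.+-comm b d) })
    (λ { (a , b) → cong₂ _,_ (R.+-identityˡ a) (R.+-identityˡ b) })
    (λ { (a , b) → cong₂ _,_ (R.-‿inverseˡ a) (R.-‿inverseˡ b) })
    (λ { (a , b) (c , d) (e , f) → cong₂ _,_ (R.*-assoc a c e)
        (solve 6 (λ a b c d e f → a :* c :* f :+ (a :* d :+ b :* c) :* e := a :* (c :* f :+ d :* e) :+ b :* (c :* e)) refl a b c d e f) })
    (λ { (a , b) (c , d) → cong₂ _,_ (R.*-comm a c)
        (solve 4 (λ a b c d → a :* d :+ b :* c := c :* b :+ d :* a) refl a b c d) })
    (λ { (a , b) → cong₂ _,_ (R.*-identityˡ a) (solve 2 (λ a b → :1 :* b :+ :0 :* a := b) refl a b) })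
    (λ { (a , b) (c , d) (e , f) → cong₂ _,_ (R.distribʳ a c e)
        (solve 6 (λ a b c d e f → (c :+ e) :* b :+ (d :+ f) :* a := (c :* b :+ d :* a) :+ (e :* b :+ f :* a)) refl a b c d e f) })

  private module E = CommutativeRingTheory isCommutativeRing

  embed : A → A[ε]
  embed a = (a , R.0#)

  embed-isRingHomomorphism : IsRingHomomorphism R.rawRing E.rawRing embed
  embed-isRingHomomorphism = mkIsRingHomomorphism embed
    (λ a b → cong (a R.+ b ,_) (solve 0 (:0 := :0 :+ :0) refl))
    (λ a b → cong (a R.* b ,_) (solve 2 (λ a b → :0 := a :* :0 :+ :0 :* b) refl a b))
    (λ a → cong (R.- a ,_) (solve 0 (:0 := :- :0) refl))
    refl refl

  sumOver-pair : ∀ {I : Set} (L : List I) (f g : I → A) → E.sumOver L (λ k → (f k , g k)) ≡ (R.sumOver L f , R.sumOver L g)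
  sumOver-pair []      f g = refl
  sumOver-pair (k ∷ L) f g = cong ((f k , g k) +_) (sumOver-pair L f g)

  -- (a , a * b) is a + a b ε, the dual number with value a and logarithmic
  -- derivative b; logarithmic derivatives add up under multiplication.
  log-derivative-* : ∀ a b c d → (a , a R.* b) * (c , c R.* d) ≡ (a R.* c , (a R.* c) R.* (b R.+ d))
  log-derivative-* a b c d = cong (a R.* c ,_)
    (solve 4 (λ a b c d → a :* (c :* d) :+ a :* b :* c := a :* c :* (b :+ d)) refl a b c d)

  log-derivative-^ : ∀ a b m → (a , a R.* b) E.^ m ≡ (a R.^ m , (a R.^ m) R.* ((m R.· R.1#) R.* b))
  log-derivative-^ a b zero    = cong (R.1# ,_) (solve 2 (λ b u → :0 := u :* (:0 :* b)) refl b R.1#)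
  log-derivative-^ a b (suc m) = begin
    (a , a R.* b) * (a , a R.* b) E.^ m                                    ≡⟨ cong ((a , a R.* b) *_) (log-derivative-^ a b m) ⟩
    (a , a R.* b) * (a R.^ m , (a R.^ m) R.* ((m R.· R.1#) R.* b))         ≡⟨ log-derivative-* a b (a R.^ m) ((m R.· R.1#) R.* b) ⟩
    (a R.* a R.^ m , (a R.* a R.^ m) R.* (b R.+ (m R.· R.1#) R.* b))
      ≡⟨ cong (λ t → (a R.* a R.^ m , (a R.* a R.^ m) R.* t)) (solve 2 (λ b k → b :+ k :* b := (:1 :+ k) :* b) refl b (m R.· R.1#)) ⟩
    (a R.* a R.^ m , (a R.* a R.^ m) R.* ((R.1# R.+ m R.· R.1#) R.* b))    ∎
    where open ≡-Reasoning

  log-derivative-product : ∀ {n} (a c : Fin n → A) → (∀ j → a j R.* c j ≡ R.1#) →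
    E.product (λ j → (a j , R.1#)) ≡ (R.product a , R.product a R.* R.sum c)
  log-derivative-product {zero}  a c inv = cong (R.1# ,_) (sym (R.zeroʳ R.1#))
  log-derivative-product {suc n} a c inv = begin
    (a Fin.zero , R.1#) * E.product (λ j → (a (Fin.suc j) , R.1#))
      ≡⟨ cong₂ _*_ (cong (a Fin.zero ,_) (sym (inv Fin.zero)))
                   (log-derivative-product (λ j → a (Fin.suc j)) (λ j → c (Fin.suc j)) (λ j → inv (Fin.suc j))) ⟩
    (a Fin.zero , a Fin.zero R.* c Fin.zero) * (R.product (λ j → a (Fin.suc j)) , R.product (λ j → a (Fin.suc j)) R.* R.sum (λ j → c (Fin.suc j)))
      ≡⟨ log-derivative-* _ _ _ _ ⟩
    (R.product a , R.product a R.* R.sum c) ∎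
    where open ≡-Reasoning

module Polynomials {A : Set} {add mul : A → A → A} {neg : A → A} {zero# one# : A}
  (isCR : IsCommutativeRing _≡_ add mul neg zero# one#) where

  private module R = CommutativeRingTheory isCR
  open ≡-Reasoning

  infixl 6 _+ₚ_ _-ₚ_
  infixl 7 _*ₚ_ _·ₚ_
  infixr 8 _^ₚ_

  -- Coefficient lists, constant coefficient first.
  Poly : Set
  Poly = List A

  _+ₚ_ : Poly → Poly → Poly
  []      +ₚ q       = q
  (a ∷ p) +ₚ []      = a ∷ p
  (a ∷ p) +ₚ (b ∷ q) = a R.+ b ∷ p +ₚ q

  _·ₚ_ : A → Poly → Poly
  c ·ₚ p = List.map (c R.*_) p

  _-ₚ_ : Poly → Poly → Poly
  p -ₚ q = p +ₚ R.- R.1# ·ₚ q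

  _*ₚ_ : Poly → Poly → Poly
  []      *ₚ q = []
  (a ∷ p) *ₚ q = a ·ₚ q +ₚ (R.0# ∷ p *ₚ q)

  constₚ : A → Poly
  constₚ c = c ∷ []

  X : Poly
  X = R.0# ∷ R.1# ∷ []

  _^ₚ_ : Poly → ℕ → Poly
  p ^ₚ zero  = constₚ R.1#
  p ^ₚ suc k = p *ₚ p ^ₚ k

  sumₚ : {I : Set} → List I → (I → Poly) → Poly
  sumₚ L f = List.foldr (λ k acc → f k +ₚ acc) [] L

  productₚ : ∀ {n} → (Fin n → Poly) → Poly
  productₚ {zero}  f = constₚ R.1#
  productₚ {suc n} f = f Fin.zero *ₚ productₚ (λ j → f (Fin.suc j))

  module Evaluation {B : Set} {addB mulB : B → B → B} {negB : B → B} {zeroB oneB : B}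
    (isCRB : IsCommutativeRing _≡_ addB mulB negB zeroB oneB)
    {ι : A → B} (ι-hom : IsRingHomomorphism R.rawRing (CommutativeRingTheory.rawRing isCRB) ι) where

    private module T = CommutativeRingTheory isCRB
    open T using (_+_; _*_; _-_; -_; 0#; 1#; _^_; sumOver; product)
    open IsRingHomomorphism ι-hom
    open T using (solve; _:=_; _:+_; _:*_; :-_; _:-_; :0; :1)

    eval : Poly → B → B
    eval []      z = 0#
    eval (a ∷ p) z = ι a + z * eval p z

    eval-+ₚ : ∀ p q z → eval (p +ₚ q) z ≡ eval p z + eval q z
    eval-+ₚ []      q       z = sym (T.+-identityˡ _)
    eval-+ₚ (a ∷ p) []      z = sym (T.+-identityʳ _)
    eval-+ₚ (a ∷ p) (b ∷ q) z = begin
      ι (a R.+ b) + z * eval (p +ₚ q) z        ≡⟨ cong₂ (λ s t → s + z * t) (+-homo a b) (eval-+ₚ p q z) ⟩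
      (ι a + ι b) + z * (eval p z + eval q z)
        ≡⟨ solve 5 (λ a b z u v → (a :+ b) :+ z :* (u :+ v) := (a :+ z :* u) :+ (b :+ z :* v)) refl (ι a) (ι b) z (eval p z) (eval q z) ⟩
      (ι a + z * eval p z) + (ι b + z * eval q z) ∎

    eval-·ₚ : ∀ c p z → eval (c ·ₚ p) z ≡ ι c * eval p z
    eval-·ₚ c []      z = sym (T.zeroʳ _)
    eval-·ₚ c (a ∷ p) z = begin
      ι (c R.* a) + z * eval (c ·ₚ p) z  ≡⟨ cong₂ (λ s t → s + z * t) (*-homo c a) (eval-·ₚ c p z) ⟩
      ι c * ι a + z * (ι c * eval p z)   ≡⟨ solve 4 (λ c a z u → c :* a :+ z :* (c :* u) := c :* (a :+ z :* u)) refl (ι c) (ι a) z (eval p z) ⟩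
      ι c * (ι a + z * eval p z)         ∎

    eval-*ₚ : ∀ p q z → eval (p *ₚ q) z ≡ eval p z * eval q z
    eval-*ₚ []      q z = sym (T.zeroˡ _)
    eval-*ₚ (a ∷ p) q z = begin
      eval (a ·ₚ q +ₚ (R.0# ∷ p *ₚ q)) z                 ≡⟨ eval-+ₚ (a ·ₚ q) (R.0# ∷ p *ₚ q) z ⟩
      eval (a ·ₚ q) z + (ι R.0# + z * eval (p *ₚ q) z)  ≡⟨ cong₂ (λ s u → s + (ι R.0# + z * u)) (eval-·ₚ a q z) (eval-*ₚ p q z) ⟩
      ι a * eval q z + (ι R.0# + z * (eval p z * eval q z))
        ≡⟨ cong (λ t → ι a * eval q z + (t + z * (eval p z * eval q z))) 0#-homo ⟩
      ι a * eval q z + (0# + z * (eval p z * eval q z))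
        ≡⟨ solve 4 (λ a u z v → a :* u :+ (:0 :+ z :* (v :* u)) := (a :+ z :* v) :* u) refl (ι a) (eval q z) z (eval p z) ⟩
      (ι a + z * eval p z) * eval q z                    ∎

    eval-constₚ : ∀ c z → eval (constₚ c) z ≡ ι c
    eval-constₚ c z = trans (cong (ι c +_) (T.zeroʳ z)) (T.+-identityʳ _)

    eval-X : ∀ z → eval X z ≡ z
    eval-X z = begin
      ι R.0# + z * eval (constₚ R.1#) z ≡⟨ cong₂ (λ s t → s + z * t) 0#-homo (trans (eval-constₚ R.1# z) 1#-homo) ⟩
      0# + z * 1#                        ≡⟨ solve 1 (λ z → :0 :+ z :* :1 := z) refl z ⟩
      z                                  ∎

    eval-^ₚ : ∀ p k z → eval (p ^ₚ k) z ≡ eval p z ^ k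
    eval-^ₚ p zero    z = trans (eval-constₚ R.1# z) 1#-homo
    eval-^ₚ p (suc k) z = trans (eval-*ₚ p (p ^ₚ k) z) (cong (eval p z *_) (eval-^ₚ p k z))

    eval-sumₚ : ∀ {I : Set} (L : List I) f z → eval (sumₚ L f) z ≡ sumOver L (λ k → eval (f k) z)
    eval-sumₚ []      f z = refl
    eval-sumₚ (k ∷ L) f z = trans (eval-+ₚ (f k) (sumₚ L f) z) (cong (eval (f k) z +_) (eval-sumₚ L f z))

    eval-productₚ : ∀ {n} (f : Fin n → Poly) z → eval (productₚ f) z ≡ product (λ j → eval (f j) z)
    eval-productₚ {zero}  f z = trans (eval-constₚ R.1# z) 1#-homo
    eval-productₚ {suc n} f z = trans (eval-*ₚ (f Fin.zero) _ z) (cong (eval (f Fin.zero) z *_) (eval-productₚ (λ j → f (Fin.suc j)) z))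

    eval-null : ∀ p z → All (_≡ R.0#) p → eval p z ≡ 0#
    eval-null []      z []           = refl
    eval-null (a ∷ p) z (refl ∷ p≡0) = begin
      ι R.0# + z * eval p z ≡⟨ cong₂ (λ s t → s + z * t) 0#-homo (eval-null p z p≡0) ⟩
      0# + z * 0#           ≡⟨ solve 1 (λ z → :0 :+ z :* :0 := :0) refl z ⟩
      0#                    ∎

    eval-−ₚ : ∀ p q z → eval (p -ₚ q) z ≡ eval p z - eval q z
    eval-−ₚ p q z = begin
      eval (p +ₚ R.- R.1# ·ₚ q) z              ≡⟨ eval-+ₚ p _ z ⟩
      eval p z + eval (R.- R.1# ·ₚ q) z        ≡⟨ cong (eval p z +_) (eval-·ₚ (R.- R.1#) q z) ⟩
      eval p z + ι (R.- R.1#) * eval q z       ≡⟨ cong (λ t → eval p z + t * eval q z) (trans (-‿homo R.1#) (cong -_ 1#-homo)) ⟩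
      eval p z + - 1# * eval q z               ≡⟨ solve 2 (λ u v → u :+ :- :1 :* v := u :- v) refl (eval p z) (eval q z) ⟩
      eval p z - eval q z                      ∎

    difference-null⇒eval-≡ : ∀ p q → All (_≡ R.0#) (p -ₚ q) → ∀ z → eval p z ≡ eval q z
    difference-null⇒eval-≡ p q null z = begin
      eval p z                          ≡⟨ solve 2 (λ u v → u := (u :- v) :+ v) refl (eval p z) (eval q z) ⟩
      (eval p z - eval q z) + eval q z  ≡⟨ cong (_+ eval q z) (trans (sym (eval-−ₚ p q z)) (eval-null (p -ₚ q) z null)) ⟩
      0# + eval q z                     ≡⟨ T.+-identityˡ _ ⟩
      eval q z                          ∎

  module Eᴬ = Evaluation isCR (Identity.isRingHomomorphism R.rawRing refl)
  open Eᴬ public using () renaming (eval to evalᴬ)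
  open R using (_+_; _*_; _-_; _·_; 0#; 1#; solve; _:=_; _:+_; _:*_; _:-_; :0)

  quotient : A → Poly → Poly
  quotient a []      = []
  quotient a (d ∷ r) = evalᴬ (d ∷ r) a ∷ quotient a r

  length-quotient : ∀ a q → List.length (quotient a q) ≡ List.length q
  length-quotient a []      = refl
  length-quotient a (d ∷ r) = cong suc (length-quotient a r)

  eval-division : ∀ c q x a → evalᴬ (c ∷ q) x ≡ evalᴬ (c ∷ q) a + (x - a) * evalᴬ (quotient a q) x
  eval-division c []      x a = solve 3 (λ c x a → c :+ x :* :0 := (c :+ a :* :0) :+ (x :- a) :* :0) refl c x a
  eval-division c (d ∷ r) x a = begin
    c + x * evalᴬ (d ∷ r) x
      ≡⟨ cong (λ t → c + x * t) (eval-division d r x a) ⟩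
    c + x * (evalᴬ (d ∷ r) a + (x - a) * evalᴬ (quotient a r) x)
      ≡⟨ solve 5 (λ c x a u w → c :+ x :* (u :+ (x :- a) :* w) := (c :+ a :* u) :+ (x :- a) :* (u :+ x :* w))
                 refl c x a (evalᴬ (d ∷ r) a) (evalᴬ (quotient a r) x) ⟩
    (c + a * evalᴬ (d ∷ r) a) + (x - a) * (evalᴬ (d ∷ r) a + x * evalᴬ (quotient a r) x) ∎

  private
    constant-zero : ∀ c a u → u ≡ 0# → c + a * u ≡ 0# → c ≡ 0#
    constant-zero c a u refl c+a0≡0 = trans (sym (solve 2 (λ c a → c :+ a :* :0 := c) refl c a)) c+a0≡0

  null-quotient⇒null : ∀ c q a → All (_≡ 0#) (quotient a q) → evalᴬ (c ∷ q) a ≡ 0# → All (_≡ 0#) (c ∷ q)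
  null-quotient⇒null c []      a []           p[a]≡0 = constant-zero c a 0# refl p[a]≡0 ∷ []
  null-quotient⇒null c (d ∷ r) a (q[a]≡0 ∷ Q≡0) p[a]≡0 =
    constant-zero c a _ q[a]≡0 p[a]≡0 ∷ null-quotient⇒null d r a Q≡0 q[a]≡0

  module _ (regular : ∀ k {y} → suc k · 1# * y ≡ 0# → y ≡ 0#) where

    private
      shift : ∀ b k → (suc b ℕ.+ k) · 1# - b · 1# ≡ suc k · 1#
      shift b k = begin
        (suc b ℕ.+ k) · 1# - b · 1#      ≡⟨ cong (λ t → t · 1# - b · 1#) (sym (ℕ.+-suc b k)) ⟩
        (b ℕ.+ suc k) · 1# - b · 1#      ≡⟨ cong (_- b · 1#) (R.·-homo-+ 1# b (suc k)) ⟩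
        (b · 1# + suc k · 1#) - b · 1#   ≡⟨ solve 2 (λ u v → (u :+ v) :- u := v) refl (b · 1#) (suc k · 1#) ⟩
        suc k · 1#                       ∎

      -- The quotient by X − b vanishes at b + 1, b + 2, …, so induction on the length applies.
      vanishing-from⇒null : ∀ n c q b → List.length q ≡ n →
        (∀ k → evalᴬ (c ∷ q) ((b ℕ.+ k) · 1#) ≡ 0#) → All (_≡ 0#) (c ∷ q)
      vanishing-from⇒null n c [] b _ vanishes =
        constant-zero c ((b ℕ.+ 0) · 1#) 0# refl (vanishes 0) ∷ []
      vanishing-from⇒null (suc n) c (d ∷ r) b len vanishes =
        null-quotient⇒null c (d ∷ r) a Q≡0 p[a]≡0
        where
        a = b · 1#
        p[a]≡0 : evalᴬ (c ∷ d ∷ r) a ≡ 0#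
        p[a]≡0 = trans (cong (λ t → evalᴬ (c ∷ d ∷ r) (t · 1#)) (sym (ℕ.+-identityʳ b))) (vanishes 0)
        Q-vanishes : ∀ k → evalᴬ (quotient a (d ∷ r)) ((suc b ℕ.+ k) · 1#) ≡ 0#
        Q-vanishes k = regular k (begin
          suc k · 1# * evalᴬ (quotient a (d ∷ r)) x
            ≡⟨ cong (_* evalᴬ (quotient a (d ∷ r)) x) (sym (shift b k)) ⟩
          (x - a) * evalᴬ (quotient a (d ∷ r)) x
            ≡⟨ sym (R.+-identityˡ _) ⟩
          0# + (x - a) * evalᴬ (quotient a (d ∷ r)) x
            ≡⟨ cong (_+ (x - a) * evalᴬ (quotient a (d ∷ r)) x) (sym p[a]≡0) ⟩
          evalᴬ (c ∷ d ∷ r) a + (x - a) * evalᴬ (quotient a (d ∷ r)) x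
            ≡⟨ sym (eval-division c (d ∷ r) x a) ⟩
          evalᴬ (c ∷ d ∷ r) x
            ≡⟨ cong (λ t → evalᴬ (c ∷ d ∷ r) (t · 1#)) (sym (ℕ.+-suc b k)) ⟩
          evalᴬ (c ∷ d ∷ r) ((b ℕ.+ suc k) · 1#)
            ≡⟨ vanishes (suc k) ⟩
          0# ∎)
          where x = (suc b ℕ.+ k) · 1#
        Q≡0 : All (_≡ 0#) (quotient a (d ∷ r))
        Q≡0 = vanishing-from⇒null n (evalᴬ (d ∷ r) a) (quotient a r) (suc b)
                (trans (length-quotient a r) (ℕ.suc-injective len)) Q-vanishes

    vanishing-on-ℕ⇒null : ∀ p → (∀ k → evalᴬ p (k · 1#) ≡ 0#) → All (_≡ 0#) p
    vanishing-on-ℕ⇒null []      vanishes = []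
    vanishing-on-ℕ⇒null (c ∷ q) vanishes = vanishing-from⇒null (List.length q) c q 0 refl vanishes

    agreeing-on-ℕ⇒difference-null : ∀ p q → (∀ k → evalᴬ p (k · 1#) ≡ evalᴬ q (k · 1#)) → All (_≡ 0#) (p -ₚ q)
    agreeing-on-ℕ⇒difference-null p q agree = vanishing-on-ℕ⇒null (p -ₚ q) λ k →
      trans (Eᴬ.eval-−ₚ p q (k · 1#)) (trans (cong (_- evalᴬ q (k · 1#)) (agree k)) (R.-‿inverseʳ _))

Unique⇒length≤ : ∀ {n} {xs : List (Fin n)} → Unique xs → length xs ℕ.≤ n
Unique⇒length≤ unique = Fin.injective⇒≤ (lookup-injective unique _ _)
  where
  lookup-injective : ∀ {ys : List (Fin _)} → Unique ys → ∀ i j → List.lookup ys i ≡ List.lookup ys j → i ≡ j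
  lookup-injective (y∉ ∷ u) Fin.zero    Fin.zero    eq = refl
  lookup-injective (y∉ ∷ u) Fin.zero    (Fin.suc j) eq = contradiction eq (All.lookup y∉ (∈-lookup j))
  lookup-injective (y∉ ∷ u) (Fin.suc i) Fin.zero    eq = contradiction (sym eq) (All.lookup y∉ (∈-lookup i))
  lookup-injective (y∉ ∷ u) (Fin.suc i) (Fin.suc j) eq = cong Fin.suc (lookup-injective u i j eq)

subsets⁺ : ∀ {A : Set} {P : A → Set} {xs} → All P xs → All (All P) (subsets xs)
subsets⁺ []         = [] ∷ []
subsets⁺ (px ∷ pxs) = ++⁺ (subsets⁺ pxs) (map⁺ (All.map (px ∷_) (subsets⁺ pxs)))

[]∈subsets : ∀ {A : Set} (xs : List A) → Any ([] ≡_) (subsets xs)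
[]∈subsets []       = here refl
[]∈subsets (x ∷ xs) = ++⁺ˡ ([]∈subsets xs)

Loopless : ∀ {n} → Edge n → Set
Loopless (i , j) = i ≢ j

T-∧⁻ : ∀ {x y} → T (x ∧ y) → T x × T y
T-∧⁻ = Equivalence.to T-∧

filterᵇ⁺ : ∀ {A : Set} {P : A → Set} (p : A → Bool) xs → (∀ x → T (p x) → P x) → All P (filterᵇ p xs)
filterᵇ⁺ p xs p⇒P = All.map (λ {x} → p⇒P x) (all-filter (T? ∘ p) xs)

-- The filter predicate of edges is restated, as Defs keeps it local.
edges-loopless : ∀ {n} (G : Graph n) → All Loopless (edges G)
edges-loopless {n} G = filterᵇ⁺ (λ (i , j) → (Fin.toℕ i ℕ.<ᵇ Fin.toℕ j) ∧ Graph.adj G i j)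
  (List.concatMap (λ i → List.map (i ,_) (List.allFin n)) (List.allFin n))
  λ (i , j) t → Fin.<⇒≢ (ℕ.<ᵇ⇒< _ _ (proj₁ (T-∧⁻ t)))

endpoints : ∀ {n} → List (Edge n) → List (Fin n)
endpoints []             = []
endpoints ((a , b) ∷ es) = a ∷ b ∷ endpoints es

length-endpoints : ∀ {n} (es : List (Edge n)) → length (endpoints es) ≡ 2 ℕ.* length es
length-endpoints []             = refl
length-endpoints ((a , b) ∷ es) = trans (cong (suc ∘ suc) (length-endpoints es)) (sym (ℕ.*-suc 2 (length es)))

T-not-eqᶠ⇒≢ : ∀ {n} {x y : Fin n} → T (not (eqᶠ x y)) → x ≢ y
T-not-eqᶠ⇒≢ {x = x} {y} t with x Fin.≟ y
... | yes _   = ⊥-elim t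
... | no x≢y = x≢y

avoids-endpoints : ∀ {n} {a b : Fin n} es → T (allᵇ (disjointᵇ (a , b)) es) →
                   All (a ≢_) (endpoints es) × All (b ≢_) (endpoints es)
avoids-endpoints []             _ = [] , []
avoids-endpoints ((c , d) ∷ es) t
  with ac , t₁ ← T-∧⁻ (proj₁ (T-∧⁻ t))
  with ad , t₂ ← T-∧⁻ t₁
  with bc , bd ← T-∧⁻ t₂
  with a∉ , b∉ ← avoids-endpoints es (proj₂ (T-∧⁻ t))
  = (T-not-eqᶠ⇒≢ ac ∷ T-not-eqᶠ⇒≢ ad ∷ a∉) , (T-not-eqᶠ⇒≢ bc ∷ T-not-eqᶠ⇒≢ bd ∷ b∉)

matching⇒Unique-endpoints : ∀ {n} {M : List (Edge n)} → All Loopless M → T (isMatchingᵇ M) → Unique (endpoints M)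
matching⇒Unique-endpoints []          _ = []
matching⇒Unique-endpoints (a≢b ∷ ok) t
  with disjoint , rest ← T-∧⁻ t
  with a∉ , b∉ ← avoids-endpoints _ disjoint
  = (a≢b ∷ a∉) ∷ b∉ ∷ matching⇒Unique-endpoints ok rest

matching-size : ∀ {n} {M : List (Edge n)} → All Loopless M → T (isMatchingᵇ M) → 2 ℕ.* length M ℕ.≤ n
matching-size {M = M} ok t = subst (ℕ._≤ _) (length-endpoints M) (Unique⇒length≤ (matching⇒Unique-endpoints ok t))

m-beyond-half : ∀ {n} (G : Graph n) k → n ℕ.< 2 ℕ.* k → m G k ≡ 0
m-beyond-half {n} G k n<2k =
  cong length (filter-none (T? ∘ k-matching) (All.map no-k-matching (subsets⁺ (edges-loopless G))))
  where
  k-matching : List (Edge n) → Bool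
  k-matching M = isMatchingᵇ M ∧ (length M ℕ.≡ᵇ k)
  no-k-matching : ∀ {M} → All Loopless M → ¬ T (k-matching M)
  no-k-matching {M} ok t with matching , size≡k ← T-∧⁻ {isMatchingᵇ M} t =
    ℕ.<⇒≱ n<2k (subst (λ l → 2 ℕ.* l ℕ.≤ n) (ℕ.≡ᵇ⇒≡ (length M) k size≡k) (matching-size ok matching))

m-zero-positive : ∀ {n} (G : Graph n) → 0 ℕ.< m G 0
m-zero-positive {n} G = filter-some (T? ∘ 0-matching) (Any.map (λ { refl → _ }) ([]∈subsets (edges G)))
  where
  0-matching : List (Edge n) → Bool
  0-matching M = isMatchingᵇ M ∧ (length M ℕ.≡ᵇ 0)

module RealFieldProperties (ℝ : RealField) where

  open RealField ℝ
  private module R = CommutativeRingTheory isCommutativeRing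
  open R using (solve; _:=_; _:+_; _:*_; :-_; _:-_; :0; :1)
  open ≡-Reasoning

  fromℕ≗·1 : ∀ k → fromℕ k ≡ k R.· 1r
  fromℕ≗·1 zero    = refl
  fromℕ≗·1 (suc k) = cong (1r +_) (fromℕ≗·1 k)

  ^≗^ : ∀ x k → x ^ k ≡ x R.^ k
  ^≗^ x zero    = refl
  ^≗^ x (suc k) = cong (x *_) (^≗^ x k)

  ∑≗sum : ∀ {k} (f : Fin k → R) → ∑ f ≡ R.sum f
  ∑≗sum {zero}  f = refl
  ∑≗sum {suc k} f = cong (f Fin.zero +_) (∑≗sum (λ j → f (Fin.suc j)))

  ∏≗product : ∀ {k} (f : Fin k → R) → ∏ f ≡ R.product f
  ∏≗product {zero}  f = refl
  ∏≗product {suc k} f = cong (f Fin.zero *_) (∏≗product (λ j → f (Fin.suc j)))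

  x²≥0 : ∀ x → 0r ≤ x * x
  x²≥0 x with ≤-total 0r x
  ... | inj₁ 0≤x = *-nonneg 0≤x 0≤x
  ... | inj₂ x≤0 = subst (0r ≤_) (solve 1 (λ x → (:- x) :* (:- x) := x :* x) refl x) (*-nonneg 0≤-x 0≤-x)
    where
    0≤-x : 0r ≤ - x
    0≤-x = subst₂ _≤_ (R.-‿inverseʳ x) (R.+-identityˡ (- x)) (+-mono-≤ (- x) x≤0)

  0≤1 : 0r ≤ 1r
  0≤1 = subst (0r ≤_) (R.*-identityˡ 1r) (x²≥0 1r)

  0≤x⇒0≤y⇒0≤x+y : ∀ {x y} → 0r ≤ x → 0r ≤ y → 0r ≤ x + y
  0≤x⇒0≤y⇒0≤x+y {x} {y} 0≤x 0≤y = ≤-trans 0≤y (subst (_≤ x + y) (R.+-identityˡ y) (+-mono-≤ y 0≤x))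

  1+x≢0 : ∀ {x} → 0r ≤ x → ¬ (1r + x ≡ 0r)
  1+x≢0 {x} 0≤x 1+x≡0 = 0≢1 (≤-antisym 0≤1 (subst₂ _≤_ (R.+-identityˡ 1r) (trans (R.+-comm x 1r) 1+x≡0) (+-mono-≤ 1r 0≤x)))

  0≤fromℕ : ∀ k → 0r ≤ fromℕ k
  0≤fromℕ zero    = ≤-refl 0r
  0≤fromℕ (suc k) = 0≤x⇒0≤y⇒0≤x+y 0≤1 (0≤fromℕ k)

  x≢0⇒x*y≡0⇒y≡0 : ∀ {x y} → ¬ (x ≡ 0r) → x * y ≡ 0r → y ≡ 0r
  x≢0⇒x*y≡0⇒y≡0 {x} {y} x≢0 xy≡0 = begin
    y               ≡⟨ sym (R.*-identityˡ y) ⟩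
    1r * y          ≡⟨ cong (_* y) (sym (inv-r x x≢0)) ⟩
    (x * inv x) * y ≡⟨ solve 3 (λ x i y → (x :* i) :* y := i :* (x :* y)) refl x (inv x) y ⟩
    inv x * (x * y) ≡⟨ cong (inv x *_) xy≡0 ⟩
    inv x * 0r      ≡⟨ R.zeroʳ _ ⟩
    0r              ∎

  ·1-regular : ∀ k {y} → suc k R.· 1r * y ≡ 0r → y ≡ 0r
  ·1-regular k = x≢0⇒x*y≡0⇒y≡0 (subst (λ t → ¬ (t ≡ 0r)) (fromℕ≗·1 (suc k)) (1+x≢0 (0≤fromℕ k)))

  y≢0⇒x*[y*z]/y≡x*z : ∀ {y} x z → ¬ (y ≡ 0r) → (x * (y * z)) / y ≡ x * z
  y≢0⇒x*[y*z]/y≡x*z {y} x z y≢0 = begin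
    (x * (y * z)) * inv y ≡⟨ solve 4 (λ x y z v → (x :* (y :* z)) :* v := (x :* z) :* (y :* v)) refl x y z (inv y) ⟩
    (x * z) * (y * inv y) ≡⟨ cong ((x * z) *_) (inv-r y y≢0) ⟩
    (x * z) * 1r          ≡⟨ R.*-identityʳ _ ⟩
    x * z                 ∎

  x≡½[x+x] : ∀ x → x ≡ (1r / (1r + 1r)) * (x + x)
  x≡½[x+x] x = begin
    x                               ≡⟨ sym (R.*-identityˡ x) ⟩
    1r * x                          ≡⟨ cong (_* x) (sym (inv-r (1r + 1r) (1+x≢0 0≤1))) ⟩
    ((1r + 1r) * inv (1r + 1r)) * x ≡⟨ solve 2 (λ v x → ((:1 :+ :1) :* v) :* x := (:1 :* v) :* (x :+ x)) refl (inv (1r + 1r)) x ⟩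
    (1r / (1r + 1r)) * (x + x)      ∎

  0≤sumOver : ∀ {I : Set} (L : List I) {f : I → R} → (∀ k → 0r ≤ f k) → 0r ≤ R.sumOver L f
  0≤sumOver []      0≤f = ≤-refl 0r
  0≤sumOver (k ∷ L) 0≤f = 0≤x⇒0≤y⇒0≤x+y (0≤f k) (0≤sumOver L 0≤f)

  0<c⇒fromℕ[c]+y≢0 : ∀ {c y} → 0 ℕ.< c → 0r ≤ y → ¬ (fromℕ c + y ≡ 0r)
  0<c⇒fromℕ[c]+y≢0 {suc c} {y} _ 0≤y = 1+x≢0 (0≤x⇒0≤y⇒0≤x+y (0≤fromℕ c) 0≤y) ∘ trans (sym (R.+-assoc 1r (fromℕ c) y))

  x²+1≢0 : ∀ x → ¬ (x ^ 2 + 1r ≡ 0r)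
  x²+1≢0 x = 1+x≢0 (subst (0r ≤_) (cong (x *_) (sym (R.*-identityʳ x))) (x²≥0 x)) ∘ trans (R.+-comm 1r (x ^ 2))

module MatchingPolynomialAtIPlusε (ℝ : RealField) {n : ℕ} (G : Graph n) (μ : Fin n → RealField.R ℝ) where

  open RealField ℝ
  open RealFieldProperties ℝ
  private
    module R = CommutativeRingTheory isCommutativeRing
    module P = Polynomials isCommutativeRing
  open R using (solve; _:=_; _:+_; _:*_; :-_; _:-_; :0; :1)
  open ≡-Reasoning

  ks : List ℕ
  ks = upTo (suc n)

  S₀ S₁ : R
  S₀ = R.sumOver ks (λ k → fromℕ (m G k))
  S₁ = R.sumOver ks (λ k → fromℕ k * fromℕ (m G k))

  coefficient : ℕ → R
  coefficient k = fromℕ (m G k) * sgn k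

  degree : ℕ → ℕ
  degree k = n ℕ.∸ 2 ℕ.* k

  φ π : P.Poly
  φ = P.sumₚ ks (λ k → coefficient k P.·ₚ P.X P.^ₚ degree k)
  π = P.productₚ (λ j → P.X P.-ₚ P.constₚ (μ j))

  eval-φ : ∀ x → P.evalᴬ φ x ≡ Φ ℝ G x
  eval-φ x = trans (P.Eᴬ.eval-sumₚ ks (λ k → coefficient k P.·ₚ P.X P.^ₚ degree k) x) (R.sumOver-cong ks λ k → begin
    P.evalᴬ (coefficient k P.·ₚ P.X P.^ₚ degree k) x ≡⟨ P.Eᴬ.eval-·ₚ (coefficient k) (P.X P.^ₚ degree k) x ⟩
    coefficient k * P.evalᴬ (P.X P.^ₚ degree k) x    ≡⟨ cong (coefficient k *_) (P.Eᴬ.eval-^ₚ P.X (degree k) x) ⟩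
    coefficient k * P.evalᴬ P.X x R.^ degree k       ≡⟨ cong (λ t → coefficient k * t R.^ degree k) (P.Eᴬ.eval-X x) ⟩
    coefficient k * x R.^ degree k                   ≡⟨ cong (coefficient k *_) (sym (^≗^ x (degree k))) ⟩
    coefficient k * x ^ degree k                     ∎)

  eval-π : ∀ x → P.evalᴬ π x ≡ ∏ (λ j → x - μ j)
  eval-π x = begin
    P.evalᴬ π x                                               ≡⟨ P.Eᴬ.eval-productₚ (λ j → P.X P.-ₚ P.constₚ (μ j)) x ⟩
    R.product (λ j → P.evalᴬ (P.X P.-ₚ P.constₚ (μ j)) x)     ≡⟨ R.product-cong-≗ factor ⟩
    R.product (λ j → x - μ j)                                 ≡⟨ sym (∏≗product (λ j → x - μ j)) ⟩
    ∏ (λ j → x - μ j)                                         ∎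
    where
    factor : ∀ j → P.evalᴬ (P.X P.-ₚ P.constₚ (μ j)) x ≡ x - μ j
    factor j = trans (P.Eᴬ.eval-−ₚ P.X (P.constₚ (μ j)) x) (cong₂ _-_ (P.Eᴬ.eval-X x) (P.Eᴬ.eval-constₚ (μ j) x))

  private
    module Gauss = GaussianExtension isCommutativeRing
    module ℂ = CommutativeRingTheory Gauss.isCommutativeRing
    module Dual = DualNumbers Gauss.isCommutativeRing
    module 𝔻 = CommutativeRingTheory Dual.isCommutativeRing

  i : Gauss.A[i]
  i = Gauss.i

  ⟪_⟫ : R → Gauss.A[i]
  ⟪_⟫ = Gauss.embed

  ι : R → Dual.A[ε]
  ι = Dual.embed ∘ Gauss.embed

  private
    ι-isRingHomomorphism = Composition.isRingHomomorphism trans Gauss.embed-isRingHomomorphism Dual.embed-isRingHomomorphism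
    module E = P.Evaluation Dual.isCommutativeRing ι-isRingHomomorphism
    open IsRingHomomorphism ι-isRingHomomorphism using () renaming (*-homo to ι-*-homo)
    open IsRingHomomorphism Gauss.embed-isRingHomomorphism using () renaming (*-homo to ⟪⟫-*-homo; -‿homo to ⟪⟫--homo)

  z : Dual.A[ε]
  z = (i , ℂ.1#)

  z^ : ∀ e → z 𝔻.^ e ≡ (i ℂ.^ e , i ℂ.^ e ℂ.* ((e ℂ.· ℂ.1#) ℂ.* ℂ.- i))
  z^ e = trans (cong (λ t → (i , t) 𝔻.^ e) (sym Gauss.i*-i≡1)) (Dual.log-derivative-^ i (ℂ.- i) e)

  i^2k : ∀ k → i ℂ.^ (2 ℕ.* k) ≡ ⟪ sgn k ⟫
  i^2k zero    = refl
  i^2k (suc k) = begin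
    i ℂ.^ (2 ℕ.* suc k)               ≡⟨ cong (i ℂ.^_) (ℕ.*-suc 2 k) ⟩
    i ℂ.* (i ℂ.* i ℂ.^ (2 ℕ.* k))     ≡⟨ sym (ℂ.*-assoc i i _) ⟩
    (i ℂ.* i) ℂ.* i ℂ.^ (2 ℕ.* k)     ≡⟨ cong₂ ℂ._*_ Gauss.i*i≡-1 (i^2k k) ⟩
    ℂ.- ℂ.1# ℂ.* ⟪ sgn k ⟫            ≡⟨ ℂ.-1*x≈-x ⟪ sgn k ⟫ ⟩
    ℂ.- ⟪ sgn k ⟫                     ≡⟨ sym (⟪⟫--homo (sgn k)) ⟩
    ⟪ sgn (suc k) ⟫                   ∎

  -i^n*i^n≡1 : ∀ e → (ℂ.- i) ℂ.^ e ℂ.* i ℂ.^ e ≡ ℂ.1#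
  -i^n*i^n≡1 zero    = ℂ.*-identityˡ ℂ.1#
  -i^n*i^n≡1 (suc e) = begin
    (ℂ.- i ℂ.* (ℂ.- i) ℂ.^ e) ℂ.* (i ℂ.* i ℂ.^ e)  ≡⟨ ℂ.solve 3 (λ i a b → (ℂ.:- i ℂ.:* a) ℂ.:* (i ℂ.:* b) ℂ.:= (i ℂ.:* ℂ.:- i) ℂ.:* (a ℂ.:* b)) refl i _ _ ⟩
    (i ℂ.* ℂ.- i) ℂ.* ((ℂ.- i) ℂ.^ e ℂ.* i ℂ.^ e)  ≡⟨ cong₂ ℂ._*_ Gauss.i*-i≡1 (-i^n*i^n≡1 e) ⟩
    ℂ.1# ℂ.* ℂ.1#                                  ≡⟨ ℂ.*-identityˡ ℂ.1# ⟩
    ℂ.1#                                           ∎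

  w : ℕ → Dual.A[ε]
  w k = (ℂ.1# , ((2 ℕ.* k) ℂ.· ℂ.1#) ℂ.* i)

  -- z = i (1 − i ε), so zᵉ = iᵉ (1 − e i ε); moreover iⁿ = iⁿ⁻²ᵏ (−1)ᵏ.
  sgn*z^degree : ∀ k → 2 ℕ.* k ℕ.≤ n → ι (sgn k) 𝔻.* z 𝔻.^ degree k ≡ z 𝔻.^ n 𝔻.* w k
  sgn*z^degree k 2k≤n = begin
    ι (sgn k) 𝔻.* z 𝔻.^ e
      ≡⟨ cong (ι (sgn k) 𝔻.*_) (z^ e) ⟩
    (⟪ sgn k ⟫ , ℂ.0#) 𝔻.* (I , I ℂ.* (E ℂ.* ℂ.- i))
      ≡⟨ cong₂ _,_ (ℂ.solve 2 (λ s I → s ℂ.:* I ℂ.:= (I ℂ.:* s) ℂ.:* ℂ.:1) refl ⟪ sgn k ⟫ I)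
                   (ℂ.solve 5 (λ s I E K i → s ℂ.:* (I ℂ.:* (E ℂ.:* ℂ.:- i)) ℂ.:+ ℂ.:0 ℂ.:* I
                                  ℂ.:= (I ℂ.:* s) ℂ.:* (K ℂ.:* i) ℂ.:+ ((I ℂ.:* s) ℂ.:* ((E ℂ.:+ K) ℂ.:* ℂ.:- i)) ℂ.:* ℂ.:1)
                               refl ⟪ sgn k ⟫ I E K i) ⟩
    (I ℂ.* ⟪ sgn k ⟫ , (I ℂ.* ⟪ sgn k ⟫) ℂ.* ((E ℂ.+ K) ℂ.* ℂ.- i)) 𝔻.* w k
      ≡⟨ cong (𝔻._* w k) (sym z^n) ⟩
    z 𝔻.^ n 𝔻.* w k ∎
    where
    e = degree k
    I = i ℂ.^ e
    E = e ℂ.· ℂ.1#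
    K = (2 ℕ.* k) ℂ.· ℂ.1#
    z^n : z 𝔻.^ n ≡ (I ℂ.* ⟪ sgn k ⟫ , (I ℂ.* ⟪ sgn k ⟫) ℂ.* ((E ℂ.+ K) ℂ.* ℂ.- i))
    z^n = begin
      z 𝔻.^ n                ≡⟨ cong (z 𝔻.^_) (sym (ℕ.m∸n+n≡m 2k≤n)) ⟩
      z 𝔻.^ (e ℕ.+ 2 ℕ.* k)  ≡⟨ z^ (e ℕ.+ 2 ℕ.* k) ⟩
      _                      ≡⟨ cong₂ (λ a c → (a , a ℂ.* (c ℂ.* ℂ.- i)))
                                  (trans (ℂ.^-homo-* i e (2 ℕ.* k)) (cong (I ℂ.*_) (i^2k k)))
                                  (ℂ.·-homo-+ ℂ.1# e (2 ℕ.* k)) ⟩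
      _                      ∎

  term-factor : ∀ k c → 2 ℕ.* k ℕ.≤ n ⊎ c ≡ 0 →
                ι (fromℕ c * sgn k) 𝔻.* z 𝔻.^ degree k ≡ z 𝔻.^ n 𝔻.* (ι (fromℕ c) 𝔻.* w k)
  term-factor k c (inj₁ 2k≤n) = begin
    ι (fromℕ c * sgn k) 𝔻.* z 𝔻.^ degree k           ≡⟨ cong (𝔻._* z 𝔻.^ degree k) (ι-*-homo (fromℕ c) (sgn k)) ⟩
    ι (fromℕ c) 𝔻.* ι (sgn k) 𝔻.* z 𝔻.^ degree k     ≡⟨ 𝔻.*-assoc _ _ _ ⟩
    ι (fromℕ c) 𝔻.* (ι (sgn k) 𝔻.* z 𝔻.^ degree k)   ≡⟨ cong (ι (fromℕ c) 𝔻.*_) (sgn*z^degree k 2k≤n) ⟩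
    ι (fromℕ c) 𝔻.* (z 𝔻.^ n 𝔻.* w k)               ≡⟨ 𝔻.solve 3 (λ a Z w → a 𝔻.:* (Z 𝔻.:* w) 𝔻.:= Z 𝔻.:* (a 𝔻.:* w)) refl _ _ _ ⟩
    z 𝔻.^ n 𝔻.* (ι (fromℕ c) 𝔻.* w k)               ∎
  term-factor k .0 (inj₂ refl) = begin
    ι (0r * sgn k) 𝔻.* z 𝔻.^ degree k            ≡⟨ cong (𝔻._* z 𝔻.^ degree k) (ι-*-homo 0r (sgn k)) ⟩
    ι 0r 𝔻.* ι (sgn k) 𝔻.* z 𝔻.^ degree k        ≡⟨ 𝔻.solve 4 (λ s Z Zn w → 𝔻.:0 𝔻.:* s 𝔻.:* Z 𝔻.:= Zn 𝔻.:* (𝔻.:0 𝔻.:* w)) refl _ _ _ _ ⟩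
    z 𝔻.^ n 𝔻.* (ι 0r 𝔻.* w k)                   ∎

  S₂ : R
  S₂ = R.sumOver ks (λ k → fromℕ (m G k) R.* (2 ℕ.* k) R.· 1r)

  W : Dual.A[ε]
  W = (⟪ S₀ ⟫ , i ℂ.* ⟪ S₂ ⟫)

  ι*w : ∀ c k → ι c 𝔻.* w k ≡ (⟪ c ⟫ , i ℂ.* ⟪ c R.* (2 ℕ.* k) R.· 1r ⟫)
  ι*w c k = cong₂ _,_ (ℂ.*-identityʳ ⟪ c ⟫) (begin
    ⟪ c ⟫ ℂ.* (K ℂ.* i) ℂ.+ ℂ.0# ℂ.* ℂ.1#  ≡⟨ cong (λ t → ⟪ c ⟫ ℂ.* (t ℂ.* i) ℂ.+ ℂ.0# ℂ.* ℂ.1#) (Gauss.·1≡embed (2 ℕ.* k)) ⟩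
    ⟪ c ⟫ ℂ.* (⟪ K′ ⟫ ℂ.* i) ℂ.+ ℂ.0# ℂ.* ℂ.1#
      ≡⟨ ℂ.solve 3 (λ c K i → c ℂ.:* (K ℂ.:* i) ℂ.:+ ℂ.:0 ℂ.:* ℂ.:1 ℂ.:= i ℂ.:* (c ℂ.:* K)) refl ⟪ c ⟫ ⟪ K′ ⟫ i ⟩
    i ℂ.* (⟪ c ⟫ ℂ.* ⟪ K′ ⟫)               ≡⟨ cong (i ℂ.*_) (sym (⟪⟫-*-homo c K′)) ⟩
    i ℂ.* ⟪ c R.* K′ ⟫                     ∎)
    where
    K  = (2 ℕ.* k) ℂ.· ℂ.1#
    K′ = (2 ℕ.* k) R.· 1r

  small-or-absent : ∀ k → 2 ℕ.* k ℕ.≤ n ⊎ m G k ≡ 0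
  small-or-absent k with 2 ℕ.* k ℕ.≤? n
  ... | yes 2k≤n = inj₁ 2k≤n
  ... | no  2k≰n = inj₂ (m-beyond-half G k (ℕ.≰⇒> 2k≰n))

  eval-φ-at-z : E.eval φ z ≡ z 𝔻.^ n 𝔻.* W
  eval-φ-at-z = begin
    E.eval φ z
      ≡⟨ E.eval-sumₚ ks (λ k → coefficient k P.·ₚ P.X P.^ₚ degree k) z ⟩
    𝔻.sumOver ks (λ k → E.eval (coefficient k P.·ₚ P.X P.^ₚ degree k) z)
      ≡⟨ 𝔻.sumOver-cong ks (λ k → trans (eval-term k) (term-factor k (m G k) (small-or-absent k))) ⟩
    𝔻.sumOver ks (λ k → z 𝔻.^ n 𝔻.* (ι (fromℕ (m G k)) 𝔻.* w k))
      ≡⟨ 𝔻.*-distribˡ-sumOver (z 𝔻.^ n) ks _ ⟩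
    z 𝔻.^ n 𝔻.* 𝔻.sumOver ks (λ k → ι (fromℕ (m G k)) 𝔻.* w k)
      ≡⟨ cong (z 𝔻.^ n 𝔻.*_) (trans (𝔻.sumOver-cong ks (λ k → ι*w (fromℕ (m G k)) k)) (Dual.sumOver-pair ks _ _)) ⟩
    z 𝔻.^ n 𝔻.* (ℂ.sumOver ks (λ k → ⟪ fromℕ (m G k) ⟫) , ℂ.sumOver ks (λ k → i ℂ.* ⟪ fromℕ (m G k) R.* (2 ℕ.* k) R.· 1r ⟫))
      ≡⟨ cong (λ t → z 𝔻.^ n 𝔻.* t) (cong₂ _,_ (Gauss.embed-sumOver ks _)
            (trans (ℂ.*-distribˡ-sumOver i ks _) (cong (i ℂ.*_) (Gauss.embed-sumOver ks _)))) ⟩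
    z 𝔻.^ n 𝔻.* W ∎
    where
    eval-term : ∀ k → E.eval (coefficient k P.·ₚ P.X P.^ₚ degree k) z ≡ ι (coefficient k) 𝔻.* z 𝔻.^ degree k
    eval-term k = trans (E.eval-·ₚ (coefficient k) (P.X P.^ₚ degree k) z)
                        (cong (ι (coefficient k) 𝔻.*_) (trans (E.eval-^ₚ P.X (degree k) z) (cong (𝔻._^ degree k) (E.eval-X z))))

  d : Fin n → R
  d j = inv (μ j ^ 2 + 1r)

  μ²+1-invertible : ∀ j → (μ j ^ 2 + 1r) * d j ≡ 1r
  μ²+1-invertible j = inv-r _ (x²+1≢0 (μ j))

  -- i − μⱼ, and its inverse (−μⱼ − i) / (μⱼ² + 1).
  a c : Fin n → Gauss.A[i]
  a j = i ℂ.- ⟪ μ j ⟫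
  c j = (- μ j * d j , - d j)

  a*c≡1 : ∀ j → a j ℂ.* c j ≡ ℂ.1#
  a*c≡1 j = cong₂ _,_
    (trans (solve 2 (λ μ d → (:0 :- μ) :* (:- μ :* d) :- (:1 :- :0) :* (:- d)
                              := (μ :* (μ :* :1) :+ :1) :* d) refl (μ j) (d j))
           (μ²+1-invertible j))
    (solve 2 (λ μ d → (:0 :- μ) :* (:- d) :+ (:1 :- :0) :* (:- μ :* d) := :0) refl (μ j) (d j))

  eval-π-at-z : E.eval π z ≡ (ℂ.product a , ℂ.product a ℂ.* ℂ.sum c)
  eval-π-at-z = begin
    E.eval π z                                                  ≡⟨ E.eval-productₚ (λ j → P.X P.-ₚ P.constₚ (μ j)) z ⟩
    𝔻.product (λ j → E.eval (P.X P.-ₚ P.constₚ (μ j)) z)       ≡⟨ 𝔻.product-cong-≗ factor ⟩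
    𝔻.product (λ j → (a j , ℂ.1#))                              ≡⟨ Dual.log-derivative-product a c a*c≡1 ⟩
    (ℂ.product a , ℂ.product a ℂ.* ℂ.sum c)                     ∎
    where
    factor : ∀ j → E.eval (P.X P.-ₚ P.constₚ (μ j)) z ≡ (a j , ℂ.1#)
    factor j = begin
      E.eval (P.X P.-ₚ P.constₚ (μ j)) z               ≡⟨ E.eval-−ₚ P.X (P.constₚ (μ j)) z ⟩
      E.eval P.X z 𝔻.- E.eval (P.constₚ (μ j)) z       ≡⟨ cong₂ 𝔻._-_ (E.eval-X z) (E.eval-constₚ (μ j) z) ⟩
      z 𝔻.- ι (μ j)                                    ≡⟨ cong (a j ,_) (ℂ.solve 0 (ℂ.:1 ℂ.:- ℂ.:0 ℂ.:= ℂ.:1) refl) ⟩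
      (a j , ℂ.1#)                                     ∎

  module _ (Φ≡∏ : ∀ x → Φ ℝ G x ≡ ∏ (λ j → x - μ j)) where

    eval-φ≡eval-π-at-z : E.eval φ z ≡ E.eval π z
    eval-φ≡eval-π-at-z = E.difference-null⇒eval-≡ φ π
      (P.agreeing-on-ℕ⇒difference-null ·1-regular φ π λ k → trans (eval-φ _) (trans (Φ≡∏ _) (sym (eval-π _)))) z

    private
      I N : Gauss.A[i]
      I = i ℂ.^ n
      N = n ℂ.· ℂ.1#

      zⁿW≡product : (I ℂ.* ⟪ S₀ ⟫ , I ℂ.* (i ℂ.* ⟪ S₂ ⟫) ℂ.+ (I ℂ.* (N ℂ.* ℂ.- i)) ℂ.* ⟪ S₀ ⟫)
                    ≡ (ℂ.product a , ℂ.product a ℂ.* ℂ.sum c)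
      zⁿW≡product = begin
        _                  ≡⟨ cong (𝔻._* W) (sym (z^ n)) ⟩
        z 𝔻.^ n 𝔻.* W      ≡⟨ sym eval-φ-at-z ⟩
        E.eval φ z         ≡⟨ eval-φ≡eval-π-at-z ⟩
        E.eval π z         ≡⟨ eval-π-at-z ⟩
        _                  ∎

    -- The ε-parts of both sides, with the common factor iⁿ cancelled.
    ε-parts : ⟪ S₂ ⟫ ℂ.* i ≡ ⟪ S₀ ⟫ ℂ.* (ℂ.sum c ℂ.+ (n ℂ.· ℂ.1#) ℂ.* i)
    ε-parts = ℂ.invertible⇒*-cancelˡ (-i^n*i^n≡1 n) (begin
      I ℂ.* (⟪ S₂ ⟫ ℂ.* i)
        ≡⟨ ℂ.solve 5 (λ I i s₂ s₀ N → I ℂ.:* (s₂ ℂ.:* i)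
                                    ℂ.:= (I ℂ.:* (i ℂ.:* s₂) ℂ.:+ (I ℂ.:* (N ℂ.:* ℂ.:- i)) ℂ.:* s₀) ℂ.:+ (I ℂ.:* s₀) ℂ.:* (N ℂ.:* i))
                     refl I i ⟪ S₂ ⟫ ⟪ S₀ ⟫ N ⟩
      (I ℂ.* (i ℂ.* ⟪ S₂ ⟫) ℂ.+ (I ℂ.* (N ℂ.* ℂ.- i)) ℂ.* ⟪ S₀ ⟫) ℂ.+ (I ℂ.* ⟪ S₀ ⟫) ℂ.* (N ℂ.* i)
        ≡⟨ cong₂ (λ u v → u ℂ.+ v ℂ.* (N ℂ.* i)) (cong proj₂ zⁿW≡product) (cong proj₁ zⁿW≡product) ⟩
      ℂ.product a ℂ.* ℂ.sum c ℂ.+ ℂ.product a ℂ.* (N ℂ.* i)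
        ≡⟨ cong (λ t → t ℂ.* ℂ.sum c ℂ.+ t ℂ.* (N ℂ.* i)) (sym (cong proj₁ zⁿW≡product)) ⟩
      (I ℂ.* ⟪ S₀ ⟫) ℂ.* ℂ.sum c ℂ.+ (I ℂ.* ⟪ S₀ ⟫) ℂ.* (N ℂ.* i)
        ≡⟨ ℂ.solve 4 (λ I s₀ σ Ni → (I ℂ.:* s₀) ℂ.:* σ ℂ.:+ (I ℂ.:* s₀) ℂ.:* Ni ℂ.:= I ℂ.:* (s₀ ℂ.:* (σ ℂ.:+ Ni)))
                     refl I ⟪ S₀ ⟫ (ℂ.sum c) (N ℂ.* i) ⟩
      I ℂ.* (⟪ S₀ ⟫ ℂ.* (ℂ.sum c ℂ.+ N ℂ.* i)) ∎)

    S₂≡S₀*[n-∑d] : S₂ ≡ S₀ * (n R.· 1r + R.sum (λ j → - d j))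
    S₂≡S₀*[n-∑d] = begin
      S₂                                              ≡⟨ sym (R.*-identityʳ S₂) ⟩
      S₂ * 1r                                         ≡⟨ trans (sym (Gauss.im-embed* S₂ i)) (cong proj₂ ε-parts) ⟩
      proj₂ (⟪ S₀ ⟫ ℂ.* (ℂ.sum c ℂ.+ (n ℂ.· ℂ.1#) ℂ.* i))  ≡⟨ Gauss.im-embed* S₀ _ ⟩
      S₀ * (proj₂ (ℂ.sum c) + proj₂ ((n ℂ.· ℂ.1#) ℂ.* i))  ≡⟨ cong₂ (λ s t → S₀ * (s + t)) (Gauss.im-sum c) (cong (λ t → proj₂ (t ℂ.* i)) (Gauss.·1≡embed n)) ⟩
      S₀ * (R.sum (λ j → - d j) + proj₂ (⟪ n R.· 1r ⟫ ℂ.* i))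
                                                      ≡⟨ cong (λ t → S₀ * (R.sum (λ j → - d j) + t)) (Gauss.im-embed* (n R.· 1r) i) ⟩
      S₀ * (R.sum (λ j → - d j) + n R.· 1r * 1r)      ≡⟨ solve 3 (λ s₀ σ n → s₀ :* (σ :+ n :* :1) := s₀ :* (n :+ σ)) refl S₀ (R.sum (λ j → - d j)) (n R.· 1r) ⟩
      S₀ * (n R.· 1r + R.sum (λ j → - d j))           ∎

  S₀≢0 : ¬ (S₀ ≡ 0r)
  S₀≢0 = 0<c⇒fromℕ[c]+y≢0 (m-zero-positive G) (0≤sumOver (List.applyUpTo suc n) (λ k → 0≤fromℕ (m G k)))

  S₂≡S₁+S₁ : S₂ ≡ S₁ + S₁
  S₂≡S₁+S₁ = begin
    S₂                                                    ≡⟨ R.sumOver-cong ks term ⟩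
    R.sumOver ks (λ k → (1r + 1r) * (fromℕ k * fromℕ (m G k)))  ≡⟨ R.*-distribˡ-sumOver (1r + 1r) ks _ ⟩
    (1r + 1r) * S₁                                        ≡⟨ solve 1 (λ s → (:1 :+ :1) :* s := s :+ s) refl S₁ ⟩
    S₁ + S₁                                               ∎
    where
    term : ∀ k → fromℕ (m G k) R.* (2 ℕ.* k) R.· 1r ≡ (1r + 1r) * (fromℕ k * fromℕ (m G k))
    term k = begin
      fromℕ (m G k) * (2 ℕ.* k) R.· 1r        ≡⟨ cong (fromℕ (m G k) *_) (trans (R.·1-homo-* 2 k) (cong (2 R.· 1r *_) (sym (fromℕ≗·1 k)))) ⟩
      fromℕ (m G k) * (2 R.· 1r * fromℕ k)    ≡⟨ solve 2 (λ c k → c :* ((:1 :+ (:1 :+ :0)) :* k) := (:1 :+ :1) :* (k :* c)) refl (fromℕ (m G k)) (fromℕ k) ⟩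
      (1r + 1r) * (fromℕ k * fromℕ (m G k))   ∎

  ∑μ²/[μ²+1]≡n-∑d : ∑ (λ j → μ j ^ 2 / (μ j ^ 2 + 1r)) ≡ n R.· 1r + R.sum (λ j → - d j)
  ∑μ²/[μ²+1]≡n-∑d = begin
    ∑ (λ j → μ j ^ 2 / (μ j ^ 2 + 1r))    ≡⟨ ∑≗sum (λ j → μ j ^ 2 / (μ j ^ 2 + 1r)) ⟩
    R.sum (λ j → μ j ^ 2 * d j)           ≡⟨ R.sum-cong-≗ term ⟩
    R.sum (λ j → 1r + - d j)              ≡⟨ R.sum-1#+ (λ j → - d j) ⟩
    n R.· 1r + R.sum (λ j → - d j)        ∎
    where
    term : ∀ j → μ j ^ 2 * d j ≡ 1r + - d j
    term j = trans (solve 2 (λ q e → q :* e := (q :+ :1) :* e :+ (:- e)) refl (μ j ^ 2) (d j))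
                   (cong (_+ - d j) (μ²+1-invertible j))

  2S₁≡S₀*∑μ²/[μ²+1] : (∀ x → Φ ℝ G x ≡ ∏ (λ j → x - μ j)) → S₁ + S₁ ≡ S₀ * ∑ (λ j → μ j ^ 2 / (μ j ^ 2 + 1r))
  2S₁≡S₀*∑μ²/[μ²+1] Φ≡∏ = begin
    S₁ + S₁                                   ≡⟨ sym S₂≡S₁+S₁ ⟩
    S₂                                        ≡⟨ S₂≡S₀*[n-∑d] Φ≡∏ ⟩
    S₀ * (n R.· 1r + R.sum (λ j → - d j))     ≡⟨ cong (S₀ *_) (sym ∑μ²/[μ²+1]≡n-∑d) ⟩
    S₀ * ∑ (λ j → μ j ^ 2 / (μ j ^ 2 + 1r))   ∎

lemma5p1 : (ℝ : RealField) → let open RealField ℝ in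
    (n : ℕ) (G : Graph n) (μ : Fin n → R) →
    (∀ x → Φ ℝ G x ≡ ∏ (λ j → x - μ j)) →
    av ℝ G ≡ (1r / (1r + 1r)) * ∑ (λ j → (μ j ^ 2) / ((μ j ^ 2) + 1r))
lemma5p1 ℝ n G μ Φ≡∏ = begin
  S₁ / S₀                                                  ≡⟨ cong (_/ S₀) (x≡½[x+x] S₁) ⟩
  ((1r / (1r + 1r)) * (S₁ + S₁)) / S₀                      ≡⟨ cong (λ t → ((1r / (1r + 1r)) * t) / S₀) (2S₁≡S₀*∑μ²/[μ²+1] Φ≡∏) ⟩
  ((1r / (1r + 1r)) * (S₀ * ∑ (λ j → μ j ^ 2 / (μ j ^ 2 + 1r)))) / S₀
                                                           ≡⟨ y≢0⇒x*[y*z]/y≡x*z _ _ S₀≢0 ⟩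
  (1r / (1r + 1r)) * ∑ (λ j → μ j ^ 2 / (μ j ^ 2 + 1r))    ∎
  where
  open RealField ℝ
  open RealFieldProperties ℝ
  open MatchingPolynomialAtIPlusε ℝ G μ
  open ≡-Reasoning
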